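{- Let $n,r$ be positive integers, $d=\gcd(r,n)$, $G_r=2^r+1$, and let $e$ be the least positive residue of the inverse of $\frac rd$ modulo $\frac nd$. Let $a\in\{1,\dots,2^n-2\}$ with binary expansion $a=\sum_{m=0}^{n-1}\alpha_m2^m$, and define the $d\times\frac nd$ matrix $(a_{i,j})_{0\le i\le d-1,\,0\le j\le n/d-1}$ by $a_{i,j}=\alpha_{(i-jr)\bmod n}$ (so $a\equiv\sum_{i,j}a_{i,j}2^{i-jr}\pmod{2^n-1}$). The following are equivalent: (a) $a$ is the inverse of $G_r$ modulo $2^n-1$; (b) there exists a $d\times\frac nd$ matrix $(c_{i,j})$ with entries in $\{0,1\}$ such that $$2c_{0,0}-c_{d-1,e}+1=a_{0,1}+a_{0,0},$$ $$2c_{0,j}-c_{d-1,j+e}=a_{0,j+1}+a_{0,j}\quad\text{for all } j\in\{1,\dots,\tfrac nd-1\},$$ $$2c_{i,j}-c_{i-1,j}=a_{i,j+1}+a_{i,j}\quad\text{for all } i\in\{1,\dots,d-1\},\ j\in\{0,\dots,\tfrac nd-1\},$$ where column indices are taken modulo $\frac nd$. Moreover, the matrix $(c_{i,j})$ in (b) is unique.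
   Context: Powers $2^{m}$ with arbitrary integer $m$ are understood modulo $2^n-1$, i.e. $2^m=2^{m\bmod n}$. -}

module Defs where

open import Data.Nat using (ℕ; zero; suc; _+_; _*_; _∸_; _^_; _≤_; _<_; NonZero; _/_; _%_; ≢-nonZero)
open import Data.Nat.Properties using (m^n≢0)
open import Data.Nat.GCD using (gcd; gcd[m,n]≢0; n/gcd[m,n]≢0)
open import Data.Nat.Divisibility using (_∣_)
open import Data.Integer as ℤ using (ℤ; +_)
open import Data.Sum using (inj₂)
open import Data.Product using (_×_)
open import Relation.Binary.PropositionalEquality using (_≡_)

dd : ℕ → ℕ → ℕ
dd n r = gcd r n

instance-dd : ∀ n r → .{{NonZero n}} → NonZero (dd n r)
instance-dd (suc n) r = ≢-nonZero (gcd[m,n]≢0 r (suc n) (inj₂ λ ()))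

cols : (n r : ℕ) → .{{NonZero n}} → ℕ
cols n r = _/_ n (dd n r) {{instance-dd n r}}

instance-cols : ∀ n r → .{{_ : NonZero n}} → NonZero (cols n r)
instance-cols n@(suc _) r = ≢-nonZero (n/gcd[m,n]≢0 r n {{_}} {{instance-dd n r}})

rd : (n r : ℕ) → .{{NonZero n}} → ℕ
rd n r = _/_ r (dd n r) {{instance-dd n r}}

G : ℕ → ℕ
G r = 2 ^ r + 1

bit : ℕ → ℕ → ℕ
bit a k = (_/_ a (2 ^ k) {{m^n≢0 2 k}}) % 2

-- a_{i,j} = α_{(i - j r) mod n}; (i - jr) mod n computed as (i + (n - (j r mod n))) mod n
amat : (n r a : ℕ) → .{{NonZero n}} → ℕ → ℕ → ℕ
amat n r a i j = bit a ((i + (n ∸ (j * r) % n)) % n)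

IsInverseOfG : (n r a : ℕ) → Set
IsInverseOfG n r a = (2 ^ n ∸ 1) ∣ (a * G r ∸ 1)

record CondB (n r e a : ℕ) .{{_ : NonZero n}} (c : ℕ → ℕ → ℕ) : Set where
  field
    entries01 : ∀ i j → i < dd n r → j < cols n r → c i j ≤ 1
    eq00 : + 2 ℤ.* + c 0 0 ℤ.- + c (dd n r ∸ 1) (_%_ e (cols n r) {{instance-cols n r}}) ℤ.+ + 1
           ≡ + amat n r a 0 (_%_ 1 (cols n r) {{instance-cols n r}}) ℤ.+ + amat n r a 0 0
    eq0j : ∀ j → 1 ≤ j → j < cols n r →
           + 2 ℤ.* + c 0 j ℤ.- + c (dd n r ∸ 1) (_%_ (j + e) (cols n r) {{instance-cols n r}})
           ≡ + amat n r a 0 (_%_ (j + 1) (cols n r) {{instance-cols n r}}) ℤ.+ + amat n r a 0 j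
    eqij : ∀ i j → 1 ≤ i → i < dd n r → j < cols n r →
           + 2 ℤ.* + c i j ℤ.- + c (i ∸ 1) j
           ≡ + amat n r a i (_%_ (j + 1) (cols n r) {{instance-cols n r}}) ℤ.+ + amat n r a i j

-- Multiplication by 2^r modulo 2^n − 1 rotates binary digits, so a G_r ≡ b + a where b has
-- digits β_k = α_{(k − r) mod n}. As 1 ≤ b + a ≤ 2 (2^n − 1), a inverts G_r exactly when
-- b + a = 1 + γ (2^n − 1) with γ ∈ {0, 1}, i.e. when adding b and a with end-around carry
-- gives 1; the carries C_k ∈ {0, 1} then satisfy 2 C_k − C_{k−1} + [k = 0] = β_k + α_k, and
-- conversely these equations telescope to b + a = 1 + C_{n−1} (2^n − 1).
-- Writing positions as k ≡ i − j r (mod n) with i < d, j < n/d turns the carry sequence into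
-- the matrix of (b): β at (i, j) is a_{i,j+1}, and k − 1 is (i − 1, j), or (d − 1, j + e) when
-- i = 0, because e r ≡ d (mod n). Uniqueness holds since 2 c − c′ with c, c′ ∈ {0, 1} fixes c.

module Submission where

open import Defs
open import Data.Nat using (ℕ; _+_; _*_; _∸_; _^_; _≤_; _<_; NonZero; _%_)
open import Data.Product using (_×_; ∃)
open import Function.Bundles using (_⇔_)
open import Relation.Binary.PropositionalEquality using (_≡_)

open import Data.Nat using (zero; suc; _/_; z≤n; s≤s; _≤ᵇ_; >-nonZero⁻¹)
import Data.Nat.Properties as ℕ
import Data.Nat.DivMod as ℕ
import Data.Nat.Tactic.RingSolver as ℕ
open import Data.Nat.Divisibility using (_∣_; divides; _∣0)
open import Data.Nat.GCD using (gcd[m,n]∣m; gcd[m,n]∣n)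
open import Data.Integer as ℤ using (ℤ; +_; -[1+_])
import Data.Integer.Properties as ℤ
open import Data.Integer.Tactic.RingSolver using (solve-∀)
open import Algebra.Properties.AbelianGroup ℤ.+-0-abelianGroup using (∙-cancelʳ)
open import Data.Bool using (T)
open import Data.Unit using (tt)
open import Data.Product using (Σ; _,_; proj₁; proj₂)
open import Function.Base using (case_of_)
open import Function.Bundles using (mk⇔; Equivalence)
open import Level using (0ℓ)
open import Relation.Binary.Bundles using (Setoid)
open import Relation.Binary.Structures using (IsEquivalence)
open import Relation.Binary.PropositionalEquality
  using (refl; sym; trans; cong; cong₂; subst; module ≡-Reasoning)
import Relation.Binary.Reasoning.Setoid as SetoidReasoning
open import Relation.Nullary using (¬_; contradiction)

-- Congruences of integers

pos-∸ : ∀ {x y} → y ≤ x → + (x ∸ y) ≡ + x ℤ.- + y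
pos-∸ {x} {y} y≤x = trans (sym (ℤ.⊖-≥ y≤x)) (sym (ℤ.m-n≡m⊖n x y))

infix 4 _≡_mod_

record _≡_mod_ (x y : ℤ) (m : ℕ) : Set where
  constructor _,_
  field
    quotient : ℤ
    equation : x ≡ y ℤ.+ quotient ℤ.* + m

module _ {m : ℕ} where

  ≡⇒≡-mod : ∀ {x y} → x ≡ y → x ≡ y mod m
  ≡⇒≡-mod {y = y} refl = + 0 , sym (ℤ.+-identityʳ y)

  mod-refl : ∀ {x} → x ≡ x mod m
  mod-refl = ≡⇒≡-mod refl

  mod-sym : ∀ {x y} → x ≡ y mod m → y ≡ x mod m
  mod-sym {y = y} (q , eq) = ℤ.- q , trans (lemma y q (+ m)) (cong (λ t → t ℤ.+ ℤ.- q ℤ.* + m) (sym eq))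
    where lemma : ∀ y q m → y ≡ (y ℤ.+ q ℤ.* m) ℤ.+ ℤ.- q ℤ.* m
          lemma = solve-∀

  mod-trans : ∀ {x y z} → x ≡ y mod m → y ≡ z mod m → x ≡ z mod m
  mod-trans {z = z} (q , refl) (q′ , refl) = q′ ℤ.+ q , lemma z q q′ (+ m)
    where lemma : ∀ z q q′ m → (z ℤ.+ q′ ℤ.* m) ℤ.+ q ℤ.* m ≡ z ℤ.+ (q′ ℤ.+ q) ℤ.* m
          lemma = solve-∀

  mod-isEquivalence : IsEquivalence (λ x y → x ≡ y mod m)
  mod-isEquivalence = record { refl = mod-refl ; sym = mod-sym ; trans = mod-trans }

mod-setoid : ℕ → Setoid 0ℓ 0ℓ
mod-setoid m = record { isEquivalence = mod-isEquivalence {m} }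

module ≡-mod-Reasoning (m : ℕ) = SetoidReasoning (mod-setoid m)

module _ {m : ℕ} where

  +-cong-mod : ∀ {x y u v} → x ≡ y mod m → u ≡ v mod m → x ℤ.+ u ≡ y ℤ.+ v mod m
  +-cong-mod {y = y} {v = v} (q , refl) (q′ , refl) = q ℤ.+ q′ , lemma y v q q′ (+ m)
    where lemma : ∀ y v q q′ m → (y ℤ.+ q ℤ.* m) ℤ.+ (v ℤ.+ q′ ℤ.* m) ≡ (y ℤ.+ v) ℤ.+ (q ℤ.+ q′) ℤ.* m
          lemma = solve-∀

  neg-cong-mod : ∀ {x y} → x ≡ y mod m → ℤ.- x ≡ ℤ.- y mod m
  neg-cong-mod {y = y} (q , refl) = ℤ.- q , lemma y q (+ m)
    where lemma : ∀ y q m → ℤ.- (y ℤ.+ q ℤ.* m) ≡ ℤ.- y ℤ.+ ℤ.- q ℤ.* m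
          lemma = solve-∀

  -‿cong-mod : ∀ {x y u v} → x ≡ y mod m → u ≡ v mod m → x ℤ.- u ≡ y ℤ.- v mod m
  -‿cong-mod p q = +-cong-mod p (neg-cong-mod q)

  *-congˡ-mod : ∀ {x y} c → x ≡ y mod m → c ℤ.* x ≡ c ℤ.* y mod m
  *-congˡ-mod {y = y} c (q , refl) = c ℤ.* q , lemma c y q (+ m)
    where lemma : ∀ c y q m → c ℤ.* (y ℤ.+ q ℤ.* m) ≡ c ℤ.* y ℤ.+ (c ℤ.* q) ℤ.* m
          lemma = solve-∀

  *-congʳ-mod : ∀ {x y} c → x ≡ y mod m → x ℤ.* c ≡ y ℤ.* c mod m
  *-congʳ-mod {x} {y} c p rewrite ℤ.*-comm x c | ℤ.*-comm y c = *-congˡ-mod c p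

  *-cong-mod : ∀ {x y u v} → x ≡ y mod m → u ≡ v mod m → x ℤ.* u ≡ y ℤ.* v mod m
  *-cong-mod {y = y} {u = u} p q = mod-trans (*-congʳ-mod u p) (*-congˡ-mod y q)

  multiple≡0-mod : ∀ k → k ℤ.* + m ≡ + 0 mod m
  multiple≡0-mod k = k , sym (ℤ.+-identityˡ (k ℤ.* + m))

  modulus≡0-mod : + m ≡ + 0 mod m
  modulus≡0-mod = subst (λ x → x ≡ + 0 mod m) (ℤ.*-identityˡ (+ m)) (multiple≡0-mod (+ 1))

  x≡x%m-mod : .{{_ : NonZero m}} → ∀ x → + x ≡ + (x % m) mod m
  x≡x%m-mod x = + (x / m) , (begin
    + x                               ≡⟨ cong +_ (ℕ.m≡m%n+[m/n]*n x m) ⟩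
    + (x % m + x / m * m)             ≡⟨ ℤ.pos-+ (x % m) (x / m * m) ⟩
    + (x % m) ℤ.+ + (x / m * m)       ≡⟨ cong (λ t → + (x % m) ℤ.+ t) (ℤ.pos-* (x / m) m) ⟩
    + (x % m) ℤ.+ + (x / m) ℤ.* + m   ∎)
    where open ≡-Reasoning

  mod-divisor : ∀ {m′ x y} → m ∣ m′ → x ≡ y mod m′ → x ≡ y mod m
  mod-divisor {y = y} (divides k refl) (q , refl) = q ℤ.* + k , (begin
    y ℤ.+ q ℤ.* + (k * m)         ≡⟨ cong (λ t → y ℤ.+ q ℤ.* t) (ℤ.pos-* k m) ⟩
    y ℤ.+ q ℤ.* (+ k ℤ.* + m)     ≡⟨ cong (λ t → y ℤ.+ t) (ℤ.*-assoc q (+ k) (+ m)) ⟨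
    y ℤ.+ q ℤ.* + k ℤ.* + m       ∎)
    where open ≡-Reasoning

  *-scale-mod : ∀ {x y} k → x ≡ y mod m → x ℤ.* + k ≡ y ℤ.* + k mod (m * k)
  *-scale-mod {y = y} k (q , refl) = q , trans (lemma y q (+ m) (+ k)) (cong (λ t → y ℤ.* + k ℤ.+ q ℤ.* t) (sym (ℤ.pos-* m k)))
    where lemma : ∀ y q m k → (y ℤ.+ q ℤ.* m) ℤ.* k ≡ y ℤ.* k ℤ.+ q ℤ.* (m ℤ.* k)
          lemma = solve-∀

  *-cancelʳ-mod : ∀ {x y} k .{{_ : NonZero k}} → x ℤ.* + k ≡ y ℤ.* + k mod (m * k) → x ≡ y mod m
  *-cancelʳ-mod {x} {y} k (q , eq) = q , ℤ.*-cancelʳ-≡ x (y ℤ.+ q ℤ.* + m) (+ k) (begin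
    x ℤ.* + k                          ≡⟨ eq ⟩
    y ℤ.* + k ℤ.+ q ℤ.* + (m * k)      ≡⟨ cong (λ t → y ℤ.* + k ℤ.+ q ℤ.* t) (ℤ.pos-* m k) ⟩
    y ℤ.* + k ℤ.+ q ℤ.* (+ m ℤ.* + k)  ≡⟨ lemma (+ k) y q (+ m) ⟩
    (y ℤ.+ q ℤ.* + m) ℤ.* + k          ∎)
    where open ≡-Reasoning
          lemma : ∀ k y q m → y ℤ.* k ℤ.+ q ℤ.* (m ℤ.* k) ≡ (y ℤ.+ q ℤ.* m) ℤ.* k
          lemma = solve-∀

  pos-+-* : ∀ y k → + (y + k * m) ≡ + y ℤ.+ + k ℤ.* + m
  pos-+-* y k = trans (ℤ.pos-+ y (k * m)) (cong (λ t → + y ℤ.+ t) (ℤ.pos-* k m))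

  mod⇒%≡ : .{{_ : NonZero m}} → ∀ {x y} → + x ≡ + y mod m → x % m ≡ y % m
  mod⇒%≡ {x} {y} (+ k , eq) = trans (cong (_% m) (ℤ.+-injective (trans eq (sym (pos-+-* y k))))) (ℕ.[m+kn]%n≡m%n y k m)
  mod⇒%≡ {x} {y} p@(-[1+ k ] , _) =
    sym (trans (cong (_% m) (ℤ.+-injective (trans (_≡_mod_.equation (mod-sym p)) (sym (pos-+-* x (suc k))))))
               (ℕ.[m+kn]%n≡m%n x (suc k) m))

  mod⇒≡ : .{{_ : NonZero m}} → ∀ {x y} → x < m → y < m → + x ≡ + y mod m → x ≡ y
  mod⇒≡ x<m y<m p = trans (sym (ℕ.m<n⇒m%n≡m x<m)) (trans (mod⇒%≡ p) (ℕ.m<n⇒m%n≡m y<m))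

  ∣∸1⇔≡1-mod : ∀ {x} → 1 ≤ x → m ∣ x ∸ 1 ⇔ + x ≡ + 1 mod m
  ∣∸1⇔≡1-mod {suc x} _ = mk⇔ to from
    where
      to : m ∣ x → + suc x ≡ + 1 mod m
      to (divides k refl) = + k , pos-+-* 1 k
      from : + suc x ≡ + 1 mod m → m ∣ x
      from (+ k , eq) = divides k (ℕ.suc-injective (ℤ.+-injective (trans eq (sym (pos-+-* 1 k)))))
      from p@(-[1+ k ] , _) = subst (m ∣_)
        (sym (ℕ.m+n≡0⇒m≡0 x (ℕ.suc-injective (ℤ.+-injective (sym (trans (_≡_mod_.equation (mod-sym p)) (sym (pos-+-* (suc x) (suc k)))))))))
        (m ∣0)

  [x+[m∸y%m]]%m≡x-y : .{{_ : NonZero m}} → ∀ x y → + ((x + (m ∸ y % m)) % m) ≡ + x ℤ.- + y mod m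
  [x+[m∸y%m]]%m≡x-y x y = begin
    + ((x + (m ∸ y % m)) % m)        ≈⟨ x≡x%m-mod (x + (m ∸ y % m)) ⟨
    + (x + (m ∸ y % m))              ≡⟨ ℤ.pos-+ x (m ∸ y % m) ⟩
    + x ℤ.+ + (m ∸ y % m)            ≡⟨ cong (λ t → + x ℤ.+ t) (pos-∸ (ℕ.m%n≤n y m)) ⟩
    + x ℤ.+ (+ m ℤ.- + (y % m))      ≈⟨ +-cong-mod (mod-refl {x = + x}) (-‿cong-mod modulus≡0-mod (mod-sym (x≡x%m-mod y))) ⟩
    + x ℤ.+ (+ 0 ℤ.- + y)            ≡⟨ cong (λ t → + x ℤ.+ t) (ℤ.+-identityˡ (ℤ.- + y)) ⟩
    + x ℤ.- + y                      ∎
    where open ≡-mod-Reasoning m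

-- Finite sums and binary digits

Σ< : ℕ → (ℕ → ℤ) → ℤ
Σ< zero    f = + 0
Σ< (suc n) f = Σ< n f ℤ.+ f n

Σ<-cong : ∀ n {f g} → (∀ k → k < n → f k ≡ g k) → Σ< n f ≡ Σ< n g
Σ<-cong zero    f≡g = refl
Σ<-cong (suc n) f≡g = cong₂ ℤ._+_ (Σ<-cong n (λ k k<n → f≡g k (ℕ.m<n⇒m<1+n k<n))) (f≡g n ℕ.≤-refl)

Σ<-distrib-+ : ∀ n f g → Σ< n (λ k → f k ℤ.+ g k) ≡ Σ< n f ℤ.+ Σ< n g
Σ<-distrib-+ zero    f g = refl
Σ<-distrib-+ (suc n) f g = trans (cong (ℤ._+ (f n ℤ.+ g n)) (Σ<-distrib-+ n f g)) (lemma (Σ< n f) (Σ< n g) (f n) (g n))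
  where lemma : ∀ a b c d → (a ℤ.+ b) ℤ.+ (c ℤ.+ d) ≡ (a ℤ.+ c) ℤ.+ (b ℤ.+ d)
        lemma = solve-∀

*-distribˡ-Σ< : ∀ n c f → c ℤ.* Σ< n f ≡ Σ< n (λ k → c ℤ.* f k)
*-distribˡ-Σ< zero    c f = ℤ.*-zeroʳ c
*-distribˡ-Σ< (suc n) c f = trans (ℤ.*-distribˡ-+ c (Σ< n f) (f n)) (cong (ℤ._+ c ℤ.* f n) (*-distribˡ-Σ< n c f))

Σ<-suc : ∀ n f → Σ< (suc n) f ≡ f 0 ℤ.+ Σ< n (λ k → f (suc k))
Σ<-suc zero    f = ℤ.+-comm (+ 0) (f 0)
Σ<-suc (suc n) f = trans (cong (ℤ._+ f (suc n)) (Σ<-suc n f)) (ℤ.+-assoc (f 0) _ _)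

fromDigits : ℕ → (ℕ → ℕ) → ℤ
fromDigits n f = Σ< n (λ k → + (f k * 2 ^ k))

fromDigits-bounded : ∀ n f → (∀ k → k < n → f k ≤ 1) → ∃ λ N → N < 2 ^ n × fromDigits n f ≡ + N
fromDigits-bounded zero    f f≤1 = 0 , s≤s z≤n , refl
fromDigits-bounded (suc n) f f≤1 with fromDigits-bounded n f (λ k k<n → f≤1 k (ℕ.m<n⇒m<1+n k<n))
... | N , N<2^n , eq = N + f n * 2 ^ n
                     , ℕ.+-mono-<-≤ N<2^n (ℕ.*-monoˡ-≤ (2 ^ n) (f≤1 n ℕ.≤-refl))
                     , trans (cong (ℤ._+ + (f n * 2 ^ n)) eq) (sym (ℤ.pos-+ N (f n * 2 ^ n)))

bit≤1 : ∀ a k → bit a k ≤ 1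
bit≤1 a k = ℕ.≤-pred (ℕ.m%n<n (_/_ a (2 ^ k) {{ℕ.m^n≢0 2 k}}) 2)

bit-zero : ∀ a → bit a 0 ≡ a % 2
bit-zero a = cong (_% 2) (ℕ.n/1≡n a)

bit-suc : ∀ a k → bit a (suc k) ≡ bit (a / 2) k
bit-suc a k = cong (_% 2) (sym (ℕ.m/n/o≡m/[n*o] a 2 (2 ^ k) {{_}} {{ℕ.m^n≢0 2 k}} {{ℕ.m^n≢0 2 (suc k)}}))

fromDigits-bit : ∀ n a → a < 2 ^ n → fromDigits n (bit a) ≡ + a
fromDigits-bit zero    a (s≤s z≤n) = refl
fromDigits-bit (suc n) a a<2^n+1 = begin
  fromDigits (suc n) (bit a)                                     ≡⟨ Σ<-suc n _ ⟩
  + (bit a 0 * 1) ℤ.+ Σ< n (λ k → + (bit a (suc k) * 2 ^ suc k))  ≡⟨ cong₂ ℤ._+_ (cong +_ (trans (ℕ.*-identityʳ _) (bit-zero a)))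
                                                                        (Σ<-cong n (λ k _ → shift k)) ⟩
  + (a % 2) ℤ.+ Σ< n (λ k → + 2 ℤ.* + (bit (a / 2) k * 2 ^ k))   ≡⟨ cong (λ t → + (a % 2) ℤ.+ t) (*-distribˡ-Σ< n (+ 2) _) ⟨
  + (a % 2) ℤ.+ + 2 ℤ.* fromDigits n (bit (a / 2))               ≡⟨ cong (λ t → + (a % 2) ℤ.+ + 2 ℤ.* t) (fromDigits-bit n (a / 2) a/2<2^n) ⟩
  + (a % 2) ℤ.+ + 2 ℤ.* + (a / 2)                                ≡⟨ cong (λ t → + (a % 2) ℤ.+ t) (sym (ℤ.pos-* 2 (a / 2))) ⟩
  + (a % 2) ℤ.+ + (2 * (a / 2))                                  ≡⟨ sym (ℤ.pos-+ (a % 2) _) ⟩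
  + (a % 2 + 2 * (a / 2))                                        ≡⟨ cong (λ t → + (a % 2 + t)) (ℕ.*-comm 2 (a / 2)) ⟩
  + (a % 2 + a / 2 * 2)                                          ≡⟨ cong +_ (ℕ.m≡m%n+[m/n]*n a 2) ⟨
  + a                                                            ∎
  where
    open ≡-Reasoning
    a/2<2^n : a / 2 < 2 ^ n
    a/2<2^n = ℕ.m<n*o⇒m/o<n (subst (a <_) (ℕ.*-comm 2 (2 ^ n)) a<2^n+1)
    shift : ∀ k → + (bit a (suc k) * 2 ^ suc k) ≡ + 2 ℤ.* + (bit (a / 2) k * 2 ^ k)
    shift k = trans (cong +_ (trans (cong (_* 2 ^ suc k) (bit-suc a k)) (lemma (bit (a / 2) k) (2 ^ k))))
                    (ℤ.pos-* 2 (bit (a / 2) k * 2 ^ k))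
      where lemma : ∀ x y → x * (2 * y) ≡ 2 * (x * y)
            lemma = ℕ.solve-∀

-- Multiplication by powers of 2 modulo 2^n − 1

Σ<-rotate-mod : ∀ {m} n g → g n ≡ g 0 mod m → Σ< n (λ k → g (suc k)) ≡ Σ< n g mod m
Σ<-rotate-mod {m} n g gn≡g0 = begin
  Σ< n (λ k → g (suc k))                ≡⟨ cancelˡ (Σ< n (λ k → g (suc k))) (g 0) ⟩
  (g 0 ℤ.+ Σ< n (λ k → g (suc k))) ℤ.- g 0 ≡⟨ cong (ℤ._- g 0) (sym (Σ<-suc n g)) ⟩
  (Σ< n g ℤ.+ g n) ℤ.- g 0               ≈⟨ -‿cong-mod (+-cong-mod (mod-refl {x = Σ< n g}) gn≡g0) mod-refl ⟩
  (Σ< n g ℤ.+ g 0) ℤ.- g 0               ≡⟨ cancelʳ (Σ< n g) (g 0) ⟩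
  Σ< n g                                 ∎
  where
    open ≡-mod-Reasoning m
    cancelˡ : ∀ x y → x ≡ (y ℤ.+ x) ℤ.- y
    cancelˡ = solve-∀
    cancelʳ : ∀ x y → (x ℤ.+ y) ℤ.- y ≡ x
    cancelʳ = solve-∀

mersenne : ℕ → ℕ
mersenne n = 2 ^ n ∸ 1

2^n≡1+mersenne : ∀ n → 2 ^ n ≡ 1 + mersenne n
2^n≡1+mersenne n = sym (ℕ.m+[n∸m]≡n (ℕ.m^n>0 2 n))

2^n≡1-mod : ∀ n → + (2 ^ n) ≡ + 1 mod mersenne n
2^n≡1-mod n = + 1 , trans (cong +_ (2^n≡1+mersenne n)) (cong (λ t → + 1 ℤ.+ t) (sym (ℤ.*-identityˡ (+ mersenne n))))

2^[t*n]≡1-mod : ∀ n t → + (2 ^ (t * n)) ≡ + 1 mod mersenne n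
2^[t*n]≡1-mod n zero    = mod-refl
2^[t*n]≡1-mod n (suc t) = begin
  + (2 ^ (n + t * n))              ≡⟨ cong +_ (ℕ.^-distribˡ-+-* 2 n (t * n)) ⟩
  + (2 ^ n * 2 ^ (t * n))          ≡⟨ ℤ.pos-* (2 ^ n) (2 ^ (t * n)) ⟩
  + (2 ^ n) ℤ.* + (2 ^ (t * n))    ≈⟨ *-cong-mod (2^n≡1-mod n) (2^[t*n]≡1-mod n t) ⟩
  + 1 ℤ.* + 1                      ∎
  where open ≡-mod-Reasoning (mersenne n)

[n∸m%n]+m≡[1+m/n]*n : ∀ m n .{{_ : NonZero n}} → (n ∸ m % n) + m ≡ suc (m / n) * n
[n∸m%n]+m≡[1+m/n]*n m n = begin
  (n ∸ m % n) + m                       ≡⟨ cong (λ t → (n ∸ m % n) + t) (ℕ.m≡m%n+[m/n]*n m n) ⟩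
  (n ∸ m % n) + (m % n + m / n * n)     ≡⟨ ℕ.+-assoc (n ∸ m % n) (m % n) (m / n * n) ⟨
  (n ∸ m % n) + m % n + m / n * n       ≡⟨ cong (_+ m / n * n) (ℕ.m∸n+n≡m (ℕ.m%n≤n m n)) ⟩
  n + m / n * n                         ∎
  where open ≡-Reasoning

fromDigits-rotate₁ : ∀ n f → (∀ k → f (k + n) ≡ f k) →
                     fromDigits n (λ k → f (suc k)) ℤ.* + 2 ≡ fromDigits n f mod mersenne n
fromDigits-rotate₁ n f f-periodic = begin
  fromDigits n (λ k → f (suc k)) ℤ.* + 2        ≡⟨ ℤ.*-comm _ (+ 2) ⟩
  + 2 ℤ.* fromDigits n (λ k → f (suc k))        ≡⟨ *-distribˡ-Σ< n (+ 2) _ ⟩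
  Σ< n (λ k → + 2 ℤ.* + (f (suc k) * 2 ^ k))    ≡⟨ Σ<-cong n (λ k _ → double k) ⟩
  Σ< n (λ k → + (f (suc k) * 2 ^ suc k))        ≈⟨ Σ<-rotate-mod n _ wrap ⟩
  fromDigits n f                                ∎
  where
    open ≡-mod-Reasoning (mersenne n)
    double : ∀ k → + 2 ℤ.* + (f (suc k) * 2 ^ k) ≡ + (f (suc k) * 2 ^ suc k)
    double k = trans (sym (ℤ.pos-* 2 (f (suc k) * 2 ^ k))) (cong +_ (lemma (f (suc k)) (2 ^ k)))
      where lemma : ∀ x y → 2 * (x * y) ≡ x * (2 * y)
            lemma = ℕ.solve-∀
    wrap : + (f n * 2 ^ n) ≡ + (f 0 * 1) mod mersenne n
    wrap = begin
      + (f n * 2 ^ n)            ≡⟨ ℤ.pos-* (f n) (2 ^ n) ⟩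
      + f n ℤ.* + (2 ^ n)        ≈⟨ *-congˡ-mod (+ f n) (2^n≡1-mod n) ⟩
      + f n ℤ.* + 1              ≡⟨ cong (λ t → + t ℤ.* + 1) (f-periodic 0) ⟩
      + f 0 ℤ.* + 1              ≡⟨ sym (ℤ.pos-* (f 0) 1) ⟩
      + (f 0 * 1)                ∎

fromDigits-rotate : ∀ n f → (∀ k → f (k + n) ≡ f k) →
                    ∀ s → fromDigits n (λ k → f (k + s)) ℤ.* + (2 ^ s) ≡ fromDigits n f mod mersenne n
fromDigits-rotate n f f-periodic zero = ≡⇒≡-mod (trans (ℤ.*-identityʳ _)
  (Σ<-cong n (λ k _ → cong (λ t → + (f t * 2 ^ k)) (ℕ.+-identityʳ k))))
fromDigits-rotate n f f-periodic (suc s) = begin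
  fromDigits n (λ k → f (k + suc s)) ℤ.* + (2 ^ suc s)            ≡⟨ cong₂ ℤ._*_ (Σ<-cong n (λ k _ → cong (λ t → + (f t * 2 ^ k)) (ℕ.+-suc k s)))
                                                                       (ℤ.pos-* 2 (2 ^ s)) ⟩
  fromDigits n (λ k → f (suc k + s)) ℤ.* (+ 2 ℤ.* + (2 ^ s))      ≡⟨ ℤ.*-assoc (fromDigits n (λ k → f (suc k + s))) (+ 2) (+ (2 ^ s)) ⟨
  fromDigits n (λ k → f (suc k + s)) ℤ.* + 2 ℤ.* + (2 ^ s)        ≈⟨ *-congʳ-mod (+ (2 ^ s))
                                                                       (fromDigits-rotate₁ n (λ k → f (k + s)) shifted-periodic) ⟩
  fromDigits n (λ k → f (k + s)) ℤ.* + (2 ^ s)                    ≈⟨ fromDigits-rotate n f f-periodic s ⟩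
  fromDigits n f                                                  ∎
  where
    open ≡-mod-Reasoning (mersenne n)
    shifted-periodic : ∀ k → f (k + n + s) ≡ f (k + s)
    shifted-periodic k = trans (cong f (ℕ.+-assoc k n s)) (trans (cong (λ t → f (k + t)) (ℕ.+-comm n s))
                         (trans (cong f (sym (ℕ.+-assoc k s n))) (f-periodic (k + s))))

-- Carries

data IsBit : ℤ → Set where
  bit0 : IsBit (+ 0)
  bit1 : IsBit (+ 1)

IsBit⇒+∣∣≡ : ∀ {z} → IsBit z → + ℤ.∣ z ∣ ≡ z
IsBit⇒+∣∣≡ bit0 = refl
IsBit⇒+∣∣≡ bit1 = refl

IsBit⇒∣∣≤1 : ∀ {z} → IsBit z → ℤ.∣ z ∣ ≤ 1
IsBit⇒∣∣≤1 bit0 = z≤n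
IsBit⇒∣∣≤1 bit1 = s≤s z≤n

≤1⇒IsBit : ∀ {x} → x ≤ 1 → IsBit (+ x)
≤1⇒IsBit z≤n       = bit0
≤1⇒IsBit (s≤s z≤n) = bit1

-- Stated through ≤ᵇ so that it evaluates on concrete integers.
Within[-1,3] : ℤ → Set
Within[-1,3] (+ t)      = T (t ≤ᵇ 3)
Within[-1,3] -[1+ t ]   = T (t ≤ᵇ 0)

bits-within[-1,3] : ∀ {p q x y} → IsBit p → IsBit q → IsBit x → IsBit y → Within[-1,3] (p ℤ.- q ℤ.+ x ℤ.+ y)
bits-within[-1,3] bit0 bit0 bit0 bit0 = tt
bits-within[-1,3] bit0 bit0 bit0 bit1 = tt
bits-within[-1,3] bit0 bit0 bit1 bit0 = tt
bits-within[-1,3] bit0 bit0 bit1 bit1 = tt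
bits-within[-1,3] bit0 bit1 bit0 bit0 = tt
bits-within[-1,3] bit0 bit1 bit0 bit1 = tt
bits-within[-1,3] bit0 bit1 bit1 bit0 = tt
bits-within[-1,3] bit0 bit1 bit1 bit1 = tt
bits-within[-1,3] bit1 bit0 bit0 bit0 = tt
bits-within[-1,3] bit1 bit0 bit0 bit1 = tt
bits-within[-1,3] bit1 bit0 bit1 bit0 = tt
bits-within[-1,3] bit1 bit0 bit1 bit1 = tt
bits-within[-1,3] bit1 bit1 bit0 bit0 = tt
bits-within[-1,3] bit1 bit1 bit0 bit1 = tt
bits-within[-1,3] bit1 bit1 bit1 bit0 = tt
bits-within[-1,3] bit1 bit1 bit1 bit1 = tt

halve-within[-1,3] : ∀ z → Within[-1,3] (+ 2 ℤ.* z) → IsBit z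
halve-within[-1,3] (+ 0)             _   = bit0
halve-within[-1,3] (+ 1)             _   = bit1
halve-within[-1,3] (+ suc (suc k))   2z≤3 =
  contradiction (ℕ.≤-trans (ℕ.*-monoʳ-≤ 2 (s≤s (s≤s (z≤n {k})))) (ℕ.≤ᵇ⇒≤ (2 * suc (suc k)) 3 2z≤3))
                λ { (s≤s (s≤s (s≤s ()))) }
halve-within[-1,3] -[1+ k ]          -1≤2z =
  contradiction (ℕ.≤-trans (ℕ.m≤n+m (1 * suc k) k) (ℕ.≤ᵇ⇒≤ _ 0 -1≤2z)) λ ()

2x-u≡2y-v⇒x≡y : ∀ {x y u v} → x ≤ 1 → y ≤ 1 → u ≤ 1 → v ≤ 1 →
                + 2 ℤ.* + x ℤ.- + u ≡ + 2 ℤ.* + y ℤ.- + v → x ≡ y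
2x-u≡2y-v⇒x≡y z≤n       z≤n       _         _         _  = refl
2x-u≡2y-v⇒x≡y (s≤s z≤n) (s≤s z≤n) _         _         _  = refl
2x-u≡2y-v⇒x≡y z≤n       (s≤s z≤n) z≤n       z≤n       ()
2x-u≡2y-v⇒x≡y z≤n       (s≤s z≤n) z≤n       (s≤s z≤n) ()
2x-u≡2y-v⇒x≡y z≤n       (s≤s z≤n) (s≤s z≤n) z≤n       ()
2x-u≡2y-v⇒x≡y z≤n       (s≤s z≤n) (s≤s z≤n) (s≤s z≤n) ()
2x-u≡2y-v⇒x≡y (s≤s z≤n) z≤n       z≤n       z≤n       ()
2x-u≡2y-v⇒x≡y (s≤s z≤n) z≤n       z≤n       (s≤s z≤n) ()
2x-u≡2y-v⇒x≡y (s≤s z≤n) z≤n       (s≤s z≤n) z≤n       ()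
2x-u≡2y-v⇒x≡y (s≤s z≤n) z≤n       (s≤s z≤n) (s≤s z≤n) ()

-- b + a ∈ [1, 2m] pins the quotient of b + a ≡ 1 (mod m) to 0 or 1.
quotient-bit : ∀ {m b a γ} → 1 ≤ m → b ≤ m → 1 ≤ a → a ≤ m → + b ℤ.+ + a ≡ + 1 ℤ.+ γ ℤ.* + m → IsBit γ
quotient-bit {γ = + 0}           _ _ _ _ _ = bit0
quotient-bit {γ = + 1}           _ _ _ _ _ = bit1
quotient-bit {m} {b} {a} {+ suc (suc k)} _ b≤m _ a≤m eq = contradiction (ℕ.≤-reflexive (sym b+a≡1+[2+k]m)) (ℕ.<⇒≱ (s≤s b+a≤[2+k]m))
  where
    b+a≡1+[2+k]m : b + a ≡ 1 + suc (suc k) * m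
    b+a≡1+[2+k]m = ℤ.+-injective (trans (sym (ℤ.pos-+ b a)) (trans eq (sym (pos-+-* {m} 1 (suc (suc k))))))
    b+a≤[2+k]m : b + a ≤ suc (suc k) * m
    b+a≤[2+k]m = ℕ.≤-trans (ℕ.+-mono-≤ b≤m a≤m) (ℕ.+-monoʳ-≤ m (ℕ.m≤m+n m (k * m)))
quotient-bit {m} {b} {a} { -[1+ k ]} 1≤m _ 1≤a _ eq = contradiction 2≤1 λ { (s≤s ()) }
  where
    move : ∀ x s m → x ≡ + 1 ℤ.+ ℤ.- s ℤ.* m → x ℤ.+ s ℤ.* m ≡ + 1
    move x s m refl = cancel s m
      where cancel : ∀ s m → (+ 1 ℤ.+ ℤ.- s ℤ.* m) ℤ.+ s ℤ.* m ≡ + 1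
            cancel = solve-∀
    b+a+[1+k]m≡1 : b + a + suc k * m ≡ 1
    b+a+[1+k]m≡1 = ℤ.+-injective (trans (pos-+-* {m} (b + a) (suc k))
                     (trans (cong (λ t → t ℤ.+ + suc k ℤ.* + m) (ℤ.pos-+ b a)) (move (+ b ℤ.+ + a) (+ suc k) (+ m) eq)))
    2≤1 : 2 ≤ 1
    2≤1 = ℕ.≤-trans (ℕ.+-mono-≤ 1≤a 1≤m)
            (ℕ.≤-trans (ℕ.+-mono-≤ (ℕ.m≤n+m a b) (ℕ.m≤m+n m (k * m))) (ℕ.≤-reflexive b+a+[1+k]m≡1))

cyclicPred : ℕ → ℕ → ℕ
cyclicPred n zero    = n ∸ 1
cyclicPred n (suc k) = k

cyclicPred<n : ∀ {n k} → k < n → cyclicPred n k < n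
cyclicPred<n {suc n} {zero}  _   = ℕ.≤-refl
cyclicPred<n {n}     {suc k} k<n = ℕ.<-trans (ℕ.n<1+n k) k<n

cyclicPred≡pred-mod : ∀ {n k} → k < n → + cyclicPred n k ≡ + k ℤ.- + 1 mod n
cyclicPred≡pred-mod {suc n} {zero}  _ = + 1 , lemma (+ n)
  where lemma : ∀ x → x ≡ + 0 ℤ.- + 1 ℤ.+ + 1 ℤ.* (+ 1 ℤ.+ x)
        lemma = solve-∀
cyclicPred≡pred-mod {n}     {suc k} _ = ≡⇒≡-mod (lemma (+ k))
  where lemma : ∀ x → x ≡ (+ 1 ℤ.+ x) ℤ.- + 1
        lemma = solve-∀

δ₀ : ℕ → ℤ
δ₀ zero    = + 1
δ₀ (suc _) = + 0

δ₀-≢0 : ∀ {k} → ¬ k ≡ 0 → δ₀ k ≡ + 0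
δ₀-≢0 {zero}  k≢0 = contradiction refl k≢0
δ₀-≢0 {suc k} _   = refl

-- CarryEq C k says that C is the carry sequence of adding the digit strings B and A with
-- end-around carry, the result having digits δ₀, i.e. being 1.
module CyclicCarry (n₀ : ℕ) (A B : ℕ → ℕ) where

  CarryEq : (ℕ → ℕ) → ℕ → Set
  CarryEq C k = + 2 ℤ.* + C k ℤ.- + C (cyclicPred (suc n₀) k) ℤ.+ δ₀ k ≡ + B k ℤ.+ + A k

  private
    n M : ℕ
    n = suc n₀
    M = mersenne n

  carries⇒sum : ∀ C → (∀ k → k < n → CarryEq C k) →
                fromDigits n B ℤ.+ fromDigits n A ≡ + 1 ℤ.+ + C n₀ ℤ.* + M
  carries⇒sum C carryEq = begin
    fromDigits n B ℤ.+ fromDigits n A                       ≡⟨ Σ<-distrib-+ n _ _ ⟨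
    Σ< n (λ k → + (B k * 2 ^ k) ℤ.+ + (A k * 2 ^ k))         ≡⟨ Σ<-cong n weighted ⟩
    Σ< n summand                                            ≡⟨ telescope n₀ ⟩
    + (2 ^ n) ℤ.* + C n₀ ℤ.- + C n₀ ℤ.+ + 1                  ≡⟨ cong (λ t → + t ℤ.* + C n₀ ℤ.- + C n₀ ℤ.+ + 1)
                                                                 (2^n≡1+mersenne n) ⟩
    + (1 + M) ℤ.* + C n₀ ℤ.- + C n₀ ℤ.+ + 1                  ≡⟨ lemma (+ M) (+ C n₀) ⟩
    + 1 ℤ.+ + C n₀ ℤ.* + M                                  ∎
    where
      open ≡-Reasoning
      summand : ℕ → ℤ
      summand k = + (2 ^ k) ℤ.* (+ 2 ℤ.* + C k ℤ.- + C (cyclicPred n k) ℤ.+ δ₀ k)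
      weighted : ∀ k → k < n → + (B k * 2 ^ k) ℤ.+ + (A k * 2 ^ k) ≡ summand k
      weighted k k<n = begin
        + (B k * 2 ^ k) ℤ.+ + (A k * 2 ^ k)          ≡⟨ cong₂ ℤ._+_ (ℤ.pos-* (B k) (2 ^ k)) (ℤ.pos-* (A k) (2 ^ k)) ⟩
        + B k ℤ.* + (2 ^ k) ℤ.+ + A k ℤ.* + (2 ^ k)  ≡⟨ ℤ.*-distribʳ-+ (+ (2 ^ k)) (+ B k) (+ A k) ⟨
        (+ B k ℤ.+ + A k) ℤ.* + (2 ^ k)              ≡⟨ ℤ.*-comm _ (+ (2 ^ k)) ⟩
        + (2 ^ k) ℤ.* (+ B k ℤ.+ + A k)              ≡⟨ cong (+ (2 ^ k) ℤ.*_) (carryEq k k<n) ⟨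
        summand k                                    ∎
      telescope : ∀ m → Σ< (suc m) summand ≡ + (2 ^ suc m) ℤ.* + C m ℤ.- + C n₀ ℤ.+ + 1
      telescope zero    = first (+ C 0) (+ C n₀)
        where first : ∀ x y → + 0 ℤ.+ + 1 ℤ.* (+ 2 ℤ.* x ℤ.- y ℤ.+ + 1) ≡ + 2 ℤ.* x ℤ.- y ℤ.+ + 1
              first = solve-∀
      telescope (suc m) = begin
        Σ< (suc m) summand ℤ.+ summand (suc m)                     ≡⟨ cong (ℤ._+ summand (suc m)) (telescope m) ⟩
        (+ (2 ^ suc m) ℤ.* + C m ℤ.- + C n₀ ℤ.+ + 1) ℤ.+ summand (suc m)
                                                                  ≡⟨ step (+ (2 ^ suc m)) (+ C (suc m)) (+ C m) (+ C n₀) ⟩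
        (+ 2 ℤ.* + (2 ^ suc m)) ℤ.* + C (suc m) ℤ.- + C n₀ ℤ.+ + 1   ≡⟨ cong (λ t → t ℤ.* + C (suc m) ℤ.- + C n₀ ℤ.+ + 1)
                                                                           (ℤ.pos-* 2 (2 ^ suc m)) ⟨
        + (2 ^ suc (suc m)) ℤ.* + C (suc m) ℤ.- + C n₀ ℤ.+ + 1       ∎
        where step : ∀ p x y z → (p ℤ.* y ℤ.- z ℤ.+ + 1) ℤ.+ p ℤ.* (+ 2 ℤ.* x ℤ.- y ℤ.+ + 0) ≡ (+ 2 ℤ.* p) ℤ.* x ℤ.- z ℤ.+ + 1
              step = solve-∀
      lemma : ∀ m c → (+ 1 ℤ.+ m) ℤ.* c ℤ.- c ℤ.+ + 1 ≡ + 1 ℤ.+ c ℤ.* m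
      lemma = solve-∀

  -- carry k is the carry into position k, written in closed form through the digits at positions ≥ k.
  module _ (γ : ℤ) (γ-bit : IsBit γ) (A≤1 : ∀ k → k < n → A k ≤ 1) (B≤1 : ∀ k → k < n → B k ≤ 1)
           (sum≡ : fromDigits n B ℤ.+ fromDigits n A ≡ + 1 ℤ.+ γ ℤ.* + M) where

    private
      column : ℕ → ℤ
      column k = + A k ℤ.+ + B k

      tailTerm : ℕ → ℕ → ℤ
      tailTerm k t = column (k + t) ℤ.* + (2 ^ t)

      tail : ℕ → ℤ
      tail k = Σ< (n ∸ k) (tailTerm k)

      carry : ℕ → ℤ
      carry k = γ ℤ.* + (2 ^ (n ∸ k)) ℤ.- tail k ℤ.+ δ₀ k

      n∸k≡1+n∸1+k : ∀ {k} → k < n → n ∸ k ≡ suc (n ∸ suc k)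
      n∸k≡1+n∸1+k k<n = ℕ.+-∸-assoc 1 k<n

      tail-step : ∀ k → k < n → tail k ≡ column k ℤ.+ + 2 ℤ.* tail (suc k)
      tail-step k k<n = begin
        tail k                                                            ≡⟨ cong (λ L → Σ< L (tailTerm k)) (n∸k≡1+n∸1+k k<n) ⟩
        Σ< (suc (n ∸ suc k)) (tailTerm k)                                 ≡⟨ Σ<-suc (n ∸ suc k) (tailTerm k) ⟩
        column (k + 0) ℤ.* + 1 ℤ.+ Σ< (n ∸ suc k) (λ t → column (k + suc t) ℤ.* + (2 ^ suc t))
                                                                          ≡⟨ cong₂ ℤ._+_ (trans (ℤ.*-identityʳ _) (cong column (ℕ.+-identityʳ k)))
                                                                                         (Σ<-cong (n ∸ suc k) (λ t _ → shift t)) ⟩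
        column k ℤ.+ Σ< (n ∸ suc k) (λ t → + 2 ℤ.* (column (suc k + t) ℤ.* + (2 ^ t)))
                                                     ≡⟨ cong (λ s → column k ℤ.+ s) (*-distribˡ-Σ< (n ∸ suc k) (+ 2) (tailTerm (suc k))) ⟨
        column k ℤ.+ + 2 ℤ.* tail (suc k)                                 ∎
        where
          open ≡-Reasoning
          shift : ∀ t → column (k + suc t) ℤ.* + (2 ^ suc t) ≡ + 2 ℤ.* (column (suc k + t) ℤ.* + (2 ^ t))
          shift t = trans (cong₂ ℤ._*_ (cong column (ℕ.+-suc k t)) (ℤ.pos-* 2 (2 ^ t)))
                          (lemma (column (suc k + t)) (+ (2 ^ t)))
            where lemma : ∀ x y → x ℤ.* (+ 2 ℤ.* y) ≡ + 2 ℤ.* (x ℤ.* y)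
                  lemma = solve-∀

      carry-step : ∀ k → k < n → + 2 ℤ.* carry (suc k) ≡ carry k ℤ.- δ₀ k ℤ.+ + A k ℤ.+ + B k
      carry-step k k<n = begin
        + 2 ℤ.* carry (suc k)
                                                                           ≡⟨ lemma γ (+ (2 ^ (n ∸ suc k))) (tail (suc k)) (+ A k) (+ B k) (δ₀ k) ⟩
        (γ ℤ.* (+ 2 ℤ.* + (2 ^ (n ∸ suc k))) ℤ.- (column k ℤ.+ + 2 ℤ.* tail (suc k)) ℤ.+ δ₀ k) ℤ.- δ₀ k ℤ.+ + A k ℤ.+ + B k
                                                                           ≡⟨ cong₂ (λ p t → (γ ℤ.* p ℤ.- t ℤ.+ δ₀ k) ℤ.- δ₀ k ℤ.+ + A k ℤ.+ + B k)
                                                                                    (sym power) (sym (tail-step k k<n)) ⟩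
        carry k ℤ.- δ₀ k ℤ.+ + A k ℤ.+ + B k                               ∎
        where
          open ≡-Reasoning
          power : + (2 ^ (n ∸ k)) ≡ + 2 ℤ.* + (2 ^ (n ∸ suc k))
          power = trans (cong (λ L → + (2 ^ L)) (n∸k≡1+n∸1+k k<n)) (ℤ.pos-* 2 (2 ^ (n ∸ suc k)))
          lemma : ∀ g p t a b d → + 2 ℤ.* (g ℤ.* p ℤ.- t ℤ.+ + 0)
                                  ≡ (g ℤ.* (+ 2 ℤ.* p) ℤ.- ((a ℤ.+ b) ℤ.+ + 2 ℤ.* t) ℤ.+ d) ℤ.- d ℤ.+ a ℤ.+ b
          lemma = solve-∀

      carry-zero : carry 0 ≡ γ
      carry-zero = begin
        γ ℤ.* + (2 ^ n) ℤ.- tail 0 ℤ.+ + 1                  ≡⟨ cong₂ (λ p t → γ ℤ.* p ℤ.- t ℤ.+ + 1)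
                                                                    (cong +_ (2^n≡1+mersenne n)) (trans tail-zero sum≡) ⟩
        γ ℤ.* (+ 1 ℤ.+ + M) ℤ.- (+ 1 ℤ.+ γ ℤ.* + M) ℤ.+ + 1  ≡⟨ lemma γ (+ M) ⟩
        γ                                                   ∎
        where
          open ≡-Reasoning
          tail-zero : tail 0 ≡ fromDigits n B ℤ.+ fromDigits n A
          tail-zero = trans (Σ<-cong n (λ t _ → split t)) (Σ<-distrib-+ n (λ t → + (B t * 2 ^ t)) (λ t → + (A t * 2 ^ t)))
            where split : ∀ t → column t ℤ.* + (2 ^ t) ≡ + (B t * 2 ^ t) ℤ.+ + (A t * 2 ^ t)
                  split t = trans (ℤ.*-distribʳ-+ (+ (2 ^ t)) (+ A t) (+ B t))
                            (trans (ℤ.+-comm (+ A t ℤ.* + (2 ^ t)) (+ B t ℤ.* + (2 ^ t)))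
                                   (sym (cong₂ ℤ._+_ (ℤ.pos-* (B t) (2 ^ t)) (ℤ.pos-* (A t) (2 ^ t)))))
          lemma : ∀ g m → g ℤ.* (+ 1 ℤ.+ m) ℤ.- (+ 1 ℤ.+ g ℤ.* m) ℤ.+ + 1 ≡ g
          lemma = solve-∀

      carry-n : carry n ≡ γ
      carry-n = trans (cong₂ (λ L K → γ ℤ.* + (2 ^ L) ℤ.- Σ< K (tailTerm n) ℤ.+ + 0) (ℕ.n∸n≡0 n) (ℕ.n∸n≡0 n)) (lemma γ)
        where lemma : ∀ g → g ℤ.* + 1 ℤ.- + 0 ℤ.+ + 0 ≡ g
              lemma = solve-∀

      carry-bit : ∀ k → k ≤ n → IsBit (carry k)
      carry-bit zero    _     = subst IsBit (sym carry-zero) γ-bit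
      carry-bit (suc k) k<n = halve-within[-1,3] (carry (suc k))
        (subst Within[-1,3] (sym (carry-step k k<n))
          (bits-within[-1,3] (carry-bit k (ℕ.<⇒≤ k<n)) (δ₀-bit k) (≤1⇒IsBit (A≤1 k k<n)) (≤1⇒IsBit (B≤1 k k<n))))
        where δ₀-bit : ∀ k → IsBit (δ₀ k)
              δ₀-bit zero    = bit1
              δ₀-bit (suc _) = bit0

      C : ℕ → ℕ
      C k = ℤ.∣ carry (suc k) ∣

      +C≡carry : ∀ k → k < n → + C k ≡ carry (suc k)
      +C≡carry k k<n = IsBit⇒+∣∣≡ (carry-bit (suc k) k<n)

      +C-pred≡carry : ∀ k → k < n → + C (cyclicPred n k) ≡ carry k
      +C-pred≡carry zero    _   = trans (+C≡carry n₀ ℕ.≤-refl) (trans carry-n (sym carry-zero))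
      +C-pred≡carry (suc k) k<n = +C≡carry k (ℕ.<-trans (ℕ.n<1+n k) k<n)

    sum⇒carries : ∃ λ C → (∀ k → k < n → C k ≤ 1) × (∀ k → k < n → CarryEq C k)
    sum⇒carries = C , (λ k k<n → IsBit⇒∣∣≤1 (carry-bit (suc k) k<n)) , carryEq
      where
        carryEq : ∀ k → k < n → CarryEq C k
        carryEq k k<n = begin
          + 2 ℤ.* + C k ℤ.- + C (cyclicPred n k) ℤ.+ δ₀ k       ≡⟨ cong₂ (λ x y → + 2 ℤ.* x ℤ.- y ℤ.+ δ₀ k)
                                                                     (+C≡carry k k<n) (+C-pred≡carry k k<n) ⟩
          + 2 ℤ.* carry (suc k) ℤ.- carry k ℤ.+ δ₀ k            ≡⟨ cong (λ t → t ℤ.- carry k ℤ.+ δ₀ k) (carry-step k k<n) ⟩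
          (carry k ℤ.- δ₀ k ℤ.+ + A k ℤ.+ + B k) ℤ.- carry k ℤ.+ δ₀ k ≡⟨ lemma (carry k) (δ₀ k) (+ A k) (+ B k) ⟩
          + B k ℤ.+ + A k                                       ∎
          where
            open ≡-Reasoning
            lemma : ∀ x d a b → (x ℤ.- d ℤ.+ a ℤ.+ b) ℤ.- x ℤ.+ d ≡ b ℤ.+ a
            lemma = solve-∀

-- Positions as matrix entries

module Grid (n r : ℕ) .{{_ : NonZero n}} where

  d ℓ ρ : ℕ
  d = dd n r
  ℓ = cols n r
  ρ = rd n r

  instance
    d≢0 : NonZero d
    d≢0 = instance-dd n r
    ℓ≢0 : NonZero ℓ
    ℓ≢0 = instance-cols n r

  d∣n : d ∣ n
  d∣n = gcd[m,n]∣n r n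

  d*ℓ≡n : d * ℓ ≡ n
  d*ℓ≡n = ℕ.m*[n/m]≡n d∣n

  d*ρ≡r : d * ρ ≡ r
  d*ρ≡r = ℕ.m*[n/m]≡n (gcd[m,n]∣m r n)

  pos : ℕ → ℕ → ℕ
  pos i j = (i + (n ∸ (j * r) % n)) % n

  pos<n : ∀ i j → pos i j < n
  pos<n i j = ℕ.m%n<n _ n

  pos≡i-jr-mod : ∀ i j → + pos i j ≡ + i ℤ.- + (j * r) mod n
  pos≡i-jr-mod i j = [x+[m∸y%m]]%m≡x-y i (j * r)

  shift : ℕ → ℕ
  shift k = (k + (n ∸ r % n)) % n

  j*r≡d*[j*ρ] : ∀ j → j * r ≡ d * (j * ρ)
  j*r≡d*[j*ρ] j = trans (cong (j *_) (sym d*ρ≡r)) (lemma j d ρ)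
    where lemma : ∀ j d p → j * (d * p) ≡ d * (j * p)
          lemma = ℕ.solve-∀

  *r-cong-mod : ∀ {x y} → x ≡ y mod ℓ → x ℤ.* + r ≡ y ℤ.* + r mod n
  *r-cong-mod x≡y = mod-divisor (divides ρ ℓ*r≡ρ*n) (*-scale-mod r x≡y)
    where
      ℓ*r≡ρ*n : ℓ * r ≡ ρ * n
      ℓ*r≡ρ*n = trans (cong (ℓ *_) (sym d*ρ≡r)) (trans (lemma ℓ d ρ) (cong (ρ *_) d*ℓ≡n))
        where lemma : ∀ c d p → c * (d * p) ≡ p * (d * c)
              lemma = ℕ.solve-∀

  [j%ℓ]*r≡j*r-mod : ∀ j → + ((j % ℓ) * r) ≡ + (j * r) mod n
  [j%ℓ]*r≡j*r-mod j = begin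
    + ((j % ℓ) * r)      ≡⟨ ℤ.pos-* (j % ℓ) r ⟩
    + (j % ℓ) ℤ.* + r    ≈⟨ *r-cong-mod (x≡x%m-mod j) ⟨
    + j ℤ.* + r          ≡⟨ ℤ.pos-* j r ⟨
    + (j * r)            ∎
    where open ≡-mod-Reasoning n

  *d-cong-mod : ∀ {x y} → x ≡ y mod ℓ → x ℤ.* + d ≡ y ℤ.* + d mod n
  *d-cong-mod {x} {y} x≡y = subst (λ m → x ℤ.* + d ≡ y ℤ.* + d mod m) (trans (ℕ.*-comm ℓ d) d*ℓ≡n) (*-scale-mod d x≡y)

  +[j*r]≡+[j*ρ]*d : ∀ j → + (j * r) ≡ + (j * ρ) ℤ.* + d
  +[j*r]≡+[j*ρ]*d j = trans (cong +_ (trans (j*r≡d*[j*ρ] j) (ℕ.*-comm d (j * ρ)))) (ℤ.pos-* (j * ρ) d)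

  j*r≡0-mod-d : ∀ j → + (j * r) ≡ + 0 mod d
  j*r≡0-mod-d j = subst (λ x → x ≡ + 0 mod d) (sym (+[j*r]≡+[j*ρ]*d j)) (multiple≡0-mod (+ (j * ρ)))

  pos-origin : pos 0 0 ≡ 0
  pos-origin = mod⇒≡ (pos<n 0 0) (>-nonZero⁻¹ n) (pos≡i-jr-mod 0 0)

  pos-next-col : ∀ i j → pos i ((j + 1) % ℓ) ≡ shift (pos i j)
  pos-next-col i j = mod⇒≡ (pos<n i ((j + 1) % ℓ)) (ℕ.m%n<n _ n) (begin
    + pos i ((j + 1) % ℓ)                  ≈⟨ pos≡i-jr-mod i ((j + 1) % ℓ) ⟩
    + i ℤ.- + (((j + 1) % ℓ) * r)          ≈⟨ -‿cong-mod (mod-refl {x = + i}) ([j%ℓ]*r≡j*r-mod (j + 1)) ⟩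
    + i ℤ.- + ((j + 1) * r)                ≡⟨ cong (λ t → + i ℤ.- t) (trans (cong +_ (distrib j r)) (ℤ.pos-+ (j * r) r)) ⟩
    + i ℤ.- (+ (j * r) ℤ.+ + r)            ≡⟨ lemma (+ i) (+ (j * r)) (+ r) ⟩
    (+ i ℤ.- + (j * r)) ℤ.- + r            ≈⟨ -‿cong-mod (pos≡i-jr-mod i j) (mod-refl {x = + r}) ⟨
    + pos i j ℤ.- + r                      ≈⟨ [x+[m∸y%m]]%m≡x-y (pos i j) r ⟨
    + shift (pos i j)                      ∎)
    where
      open ≡-mod-Reasoning n
      distrib : ∀ j r → (j + 1) * r ≡ j * r + r
      distrib = ℕ.solve-∀
      lemma : ∀ a b c → a ℤ.- (b ℤ.+ c) ≡ (a ℤ.- b) ℤ.- c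
      lemma = solve-∀

  pos-pred-row : ∀ i j → cyclicPred n (pos (suc i) j) ≡ pos i j
  pos-pred-row i j = mod⇒≡ (cyclicPred<n (pos<n (suc i) j)) (pos<n i j) (begin
    + cyclicPred n (pos (suc i) j)          ≈⟨ cyclicPred≡pred-mod (pos<n (suc i) j) ⟩
    + pos (suc i) j ℤ.- + 1                 ≈⟨ -‿cong-mod (pos≡i-jr-mod (suc i) j) (mod-refl {x = + 1}) ⟩
    (+ suc i ℤ.- + (j * r)) ℤ.- + 1         ≡⟨ lemma (+ i) (+ (j * r)) ⟩
    + i ℤ.- + (j * r)                       ≈⟨ pos≡i-jr-mod i j ⟨
    + pos i j                               ∎)
    where
      open ≡-mod-Reasoning n
      lemma : ∀ a b → (+ 1 ℤ.+ a ℤ.- b) ℤ.- + 1 ≡ a ℤ.- b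
      lemma = solve-∀

  +[[j+x]*r]≡+[j*r]+[ρ*x]*d : ∀ j x → + ((j + x) * r) ≡ + (j * r) ℤ.+ + (ρ * x) ℤ.* + d
  +[[j+x]*r]≡+[j*r]+[ρ*x]*d j x = begin
    + ((j + x) * r)                       ≡⟨ cong (λ t → + ((j + x) * t)) (sym d*ρ≡r) ⟩
    + ((j + x) * (d * ρ))                 ≡⟨ cong +_ (distrib j x d ρ) ⟩
    + (j * (d * ρ) + ρ * x * d)           ≡⟨ ℤ.pos-+ (j * (d * ρ)) (ρ * x * d) ⟩
    + (j * (d * ρ)) ℤ.+ + (ρ * x * d)     ≡⟨ cong₂ (λ s t → + (j * s) ℤ.+ t) d*ρ≡r (ℤ.pos-* (ρ * x) d) ⟩
    + (j * r) ℤ.+ + (ρ * x) ℤ.* + d       ∎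
    where
      open ≡-Reasoning
      distrib : ∀ j x d p → (j + x) * (d * p) ≡ j * (d * p) + p * x * d
      distrib = ℕ.solve-∀

  module ModularInverse (e : ℕ) (e-inverse : (ρ * e) % ℓ ≡ 1 % ℓ) where

    ρ*e≡1-mod : + (ρ * e) ≡ + 1 mod ℓ
    ρ*e≡1-mod = mod-trans (x≡x%m-mod (ρ * e)) (mod-trans (≡⇒≡-mod (cong +_ e-inverse)) (mod-sym (x≡x%m-mod 1)))

    j*ρ*e≡j-mod : ∀ j → + (j * ρ) ℤ.* + e ≡ + j mod ℓ
    j*ρ*e≡j-mod j = begin
      + (j * ρ) ℤ.* + e      ≡⟨ ℤ.pos-* (j * ρ) e ⟨
      + (j * ρ * e)          ≡⟨ cong +_ (ℕ.*-assoc j ρ e) ⟩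
      + (j * (ρ * e))        ≡⟨ ℤ.pos-* j (ρ * e) ⟩
      + j ℤ.* + (ρ * e)      ≈⟨ *-congˡ-mod (+ j) ρ*e≡1-mod ⟩
      + j ℤ.* + 1            ≡⟨ ℤ.*-identityʳ (+ j) ⟩
      + j                    ∎
      where open ≡-mod-Reasoning ℓ

    pos-injective : ∀ {i i′ j j′} → i < d → i′ < d → j < ℓ → j′ < ℓ → pos i j ≡ pos i′ j′ → i ≡ i′ × j ≡ j′
    pos-injective {i} {i′} {j} {j′} i<d i′<d j<ℓ j′<ℓ pos≡ = i≡i′ , j≡j′
      where
        i-jr≡i′-j′r : + i ℤ.- + (j * r) ≡ + i′ ℤ.- + (j′ * r) mod n
        i-jr≡i′-j′r = mod-trans (mod-sym (pos≡i-jr-mod i j)) (mod-trans (≡⇒≡-mod (cong +_ pos≡)) (pos≡i-jr-mod i′ j′))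
        add-back : ∀ x y → x ≡ (x ℤ.- y) ℤ.+ y
        add-back = solve-∀
        i≡i′ : i ≡ i′
        i≡i′ = mod⇒≡ i<d i′<d (begin
          + i                                       ≡⟨ add-back (+ i) (+ (j * r)) ⟩
          (+ i ℤ.- + (j * r)) ℤ.+ + (j * r)          ≈⟨ +-cong-mod (mod-divisor d∣n i-jr≡i′-j′r) (j*r≡0-mod-d j) ⟩
          (+ i′ ℤ.- + (j′ * r)) ℤ.+ + 0              ≈⟨ +-cong-mod (mod-refl {x = + i′ ℤ.- + (j′ * r)}) (j*r≡0-mod-d j′) ⟨
          (+ i′ ℤ.- + (j′ * r)) ℤ.+ + (j′ * r)       ≡⟨ add-back (+ i′) (+ (j′ * r)) ⟨
          + i′                                      ∎)
          where open ≡-mod-Reasoning d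
        i-jr≡i-j′r : + i ℤ.- + (j * r) ≡ + i ℤ.- + (j′ * r) mod n
        i-jr≡i-j′r = subst (λ t → + i ℤ.- + (j * r) ≡ + t ℤ.- + (j′ * r) mod n) (sym i≡i′) i-jr≡i′-j′r
        take-away : ∀ x y → y ≡ x ℤ.- (x ℤ.- y)
        take-away = solve-∀
        jr≡j′r : + (j * ρ) ℤ.* + d ≡ + (j′ * ρ) ℤ.* + d mod (ℓ * d)
        jr≡j′r = subst (λ m → + (j * ρ) ℤ.* + d ≡ + (j′ * ρ) ℤ.* + d mod m) (trans (sym d*ℓ≡n) (ℕ.*-comm d ℓ)) (begin
          + (j * ρ) ℤ.* + d                        ≡⟨ +[j*r]≡+[j*ρ]*d j ⟨
          + (j * r)                                ≡⟨ take-away (+ i) (+ (j * r)) ⟩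
          + i ℤ.- (+ i ℤ.- + (j * r))              ≈⟨ -‿cong-mod (mod-refl {x = + i}) i-jr≡i-j′r ⟩
          + i ℤ.- (+ i ℤ.- + (j′ * r))             ≡⟨ take-away (+ i) (+ (j′ * r)) ⟨
          + (j′ * r)                               ≡⟨ +[j*r]≡+[j*ρ]*d j′ ⟩
          + (j′ * ρ) ℤ.* + d                       ∎)
          where open ≡-mod-Reasoning n
        j≡j′ : j ≡ j′
        j≡j′ = mod⇒≡ j<ℓ j′<ℓ (begin
          + j                        ≈⟨ j*ρ*e≡j-mod j ⟨
          + (j * ρ) ℤ.* + e          ≈⟨ *-congʳ-mod (+ e) (*-cancelʳ-mod {x = + (j * ρ)} {y = + (j′ * ρ)} d jr≡j′r) ⟩
          + (j′ * ρ) ℤ.* + e         ≈⟨ j*ρ*e≡j-mod j′ ⟩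
          + j′                       ∎)
          where open ≡-mod-Reasoning ℓ

    pos-pred-col₀ : ∀ j → cyclicPred n (pos 0 j) ≡ pos (d ∸ 1) ((j + e) % ℓ)
    pos-pred-col₀ j = mod⇒≡ (cyclicPred<n (pos<n 0 j)) (pos<n (d ∸ 1) ((j + e) % ℓ)) (begin
      + cyclicPred n (pos 0 j)                                   ≈⟨ cyclicPred≡pred-mod (pos<n 0 j) ⟩
      + pos 0 j ℤ.- + 1                                          ≈⟨ -‿cong-mod (pos≡i-jr-mod 0 j) (mod-refl {x = + 1}) ⟩
      (+ 0 ℤ.- + (j * r)) ℤ.- + 1                                ≡⟨ lemma (+ d) (+ (j * r)) ⟨
      (+ d ℤ.- + 1) ℤ.- (+ (j * r) ℤ.+ + 1 ℤ.* + d)              ≈⟨ -‿cong-mod (mod-refl {x = + d ℤ.- + 1})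
                                                                      (+-cong-mod (mod-refl {x = + (j * r)}) (*d-cong-mod ρ*e≡1-mod)) ⟨
      (+ d ℤ.- + 1) ℤ.- (+ (j * r) ℤ.+ + (ρ * e) ℤ.* + d)        ≡⟨ cong₂ ℤ._-_ (pos-∸ (>-nonZero⁻¹ d)) (+[[j+x]*r]≡+[j*r]+[ρ*x]*d j e) ⟨
      + (d ∸ 1) ℤ.- + ((j + e) * r)                              ≈⟨ -‿cong-mod (mod-refl {x = + (d ∸ 1)}) ([j%ℓ]*r≡j*r-mod (j + e)) ⟨
      + (d ∸ 1) ℤ.- + (((j + e) % ℓ) * r)                        ≈⟨ pos≡i-jr-mod (d ∸ 1) ((j + e) % ℓ) ⟨
      + pos (d ∸ 1) ((j + e) % ℓ)                                ∎)
      where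
        open ≡-mod-Reasoning n
        lemma : ∀ d b → (d ℤ.- + 1) ℤ.- (b ℤ.+ + 1 ℤ.* d) ≡ (+ 0 ℤ.- b) ℤ.- + 1
        lemma = solve-∀

    e[ℓ∸q]ρ≡-q-mod : ∀ {q} → q ≤ ℓ → + (e * (ℓ ∸ q) * ρ) ≡ ℤ.- + q mod ℓ
    e[ℓ∸q]ρ≡-q-mod {q} q≤ℓ = begin
      + (e * (ℓ ∸ q) * ρ)           ≡⟨ cong +_ (reorder e (ℓ ∸ q) ρ) ⟩
      + (ρ * e * (ℓ ∸ q))           ≡⟨ ℤ.pos-* (ρ * e) (ℓ ∸ q) ⟩
      + (ρ * e) ℤ.* + (ℓ ∸ q)       ≈⟨ *-congʳ-mod (+ (ℓ ∸ q)) ρ*e≡1-mod ⟩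
      + 1 ℤ.* + (ℓ ∸ q)             ≡⟨ trans (ℤ.*-identityˡ _) (pos-∸ q≤ℓ) ⟩
      + ℓ ℤ.- + q                   ≈⟨ -‿cong-mod modulus≡0-mod (mod-refl {x = + q}) ⟩
      + 0 ℤ.- + q                   ≡⟨ ℤ.+-identityˡ (ℤ.- + q) ⟩
      ℤ.- + q                       ∎
      where
        open ≡-mod-Reasoning ℓ
        reorder : ∀ e x p → e * x * p ≡ p * e * x
        reorder = ℕ.solve-∀

    row col : ℕ → ℕ
    row k = k % d
    col k = (e * (ℓ ∸ k / d)) % ℓ

    row<d : ∀ k → row k < d
    row<d k = ℕ.m%n<n k d

    col<ℓ : ∀ k → col k < ℓ
    col<ℓ k = ℕ.m%n<n _ ℓ

    pos-row-col : ∀ {k} → k < n → pos (row k) (col k) ≡ k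
    pos-row-col {k} k<n = mod⇒≡ (pos<n (row k) (col k)) k<n (begin
      + pos (row k) (col k)                       ≈⟨ pos≡i-jr-mod (row k) (col k) ⟩
      + row k ℤ.- + (col k * r)                   ≈⟨ -‿cong-mod (mod-refl {x = + row k}) ([j%ℓ]*r≡j*r-mod (e * (ℓ ∸ q))) ⟩
      + row k ℤ.- + (e * (ℓ ∸ q) * r)             ≡⟨ cong (λ t → + row k ℤ.- t) (+[j*r]≡+[j*ρ]*d (e * (ℓ ∸ q))) ⟩
      + row k ℤ.- + (e * (ℓ ∸ q) * ρ) ℤ.* + d     ≈⟨ -‿cong-mod (mod-refl {x = + row k}) (*d-cong-mod (e[ℓ∸q]ρ≡-q-mod q≤ℓ)) ⟩
      + row k ℤ.- ℤ.- + q ℤ.* + d                 ≡⟨ lemma (+ row k) (+ q) (+ d) ⟩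
      + row k ℤ.+ + q ℤ.* + d                     ≡⟨ pos-+-* (row k) q ⟨
      + (k % d + k / d * d)                       ≡⟨ cong +_ (ℕ.m≡m%n+[m/n]*n k d) ⟨
      + k                                         ∎)
      where
        open ≡-mod-Reasoning n
        q : ℕ
        q = k / d
        lemma : ∀ a b c → a ℤ.- ℤ.- b ℤ.* c ≡ a ℤ.+ b ℤ.* c
        lemma = solve-∀
        q≤ℓ : q ≤ ℓ
        q≤ℓ = ℕ.<⇒≤ (ℕ.m<n*o⇒m/o<n (subst (k <_) (trans (sym d*ℓ≡n) (ℕ.*-comm d ℓ)) k<n))

    row-col-pos : ∀ {i j} → i < d → j < ℓ → row (pos i j) ≡ i × col (pos i j) ≡ j
    row-col-pos {i} {j} i<d j<ℓ =
      pos-injective (row<d (pos i j)) i<d (col<ℓ (pos i j)) j<ℓ (pos-row-col (pos<n i j))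

-- The characterisation of the inverse

module Characterisation (n₀ r e : ℕ)
  (e-inverse : _%_ (rd (suc n₀) r * e) (cols (suc n₀) r) {{instance-cols (suc n₀) r}}
               ≡ _%_ 1 (cols (suc n₀) r) {{instance-cols (suc n₀) r}})
  (a : ℕ) (1≤a : 1 ≤ a) (a≤2^n∸2 : a ≤ 2 ^ suc n₀ ∸ 2) where

  private
    n M : ℕ
    n = suc n₀
    M = mersenne n

  open Grid n r
  open ModularInverse e e-inverse

  A B : ℕ → ℕ
  A = bit a
  B k = bit a (shift k)

  open CyclicCarry n₀ A B

  a≤M : a ≤ M
  a≤M = ℕ.≤-trans a≤2^n∸2 (ℕ.∸-monoʳ-≤ (2 ^ n) (s≤s z≤n))

  fromDigits-A : fromDigits n A ≡ + a
  fromDigits-A = fromDigits-bit n a (subst (a <_) (sym (2^n≡1+mersenne n)) (s≤s a≤M))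

  fromDigits-B≡a*2^r : fromDigits n B ≡ + a ℤ.* + (2 ^ r) mod M
  fromDigits-B≡a*2^r = begin
    fromDigits n B                                            ≡⟨ ℤ.*-identityʳ (fromDigits n B) ⟨
    fromDigits n B ℤ.* + 1                                    ≈⟨ *-congˡ-mod (fromDigits n B) (2^[t*n]≡1-mod n (suc (r / n))) ⟨
    fromDigits n B ℤ.* + (2 ^ (suc (r / n) * n))              ≡⟨ cong (λ t → fromDigits n B ℤ.* + (2 ^ t)) ([n∸m%n]+m≡[1+m/n]*n r n) ⟨
    fromDigits n B ℤ.* + (2 ^ (s + r))                        ≡⟨ cong (λ t → fromDigits n B ℤ.* t)
                                                                   (trans (cong +_ (ℕ.^-distribˡ-+-* 2 s r)) (ℤ.pos-* (2 ^ s) (2 ^ r))) ⟩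
    fromDigits n B ℤ.* (+ (2 ^ s) ℤ.* + (2 ^ r))              ≡⟨ ℤ.*-assoc (fromDigits n B) (+ (2 ^ s)) (+ (2 ^ r)) ⟨
    fromDigits n B ℤ.* + (2 ^ s) ℤ.* + (2 ^ r)                ≈⟨ *-congʳ-mod (+ (2 ^ r)) (fromDigits-rotate n f f-periodic s) ⟩
    fromDigits n f ℤ.* + (2 ^ r)                              ≡⟨ cong (λ t → t ℤ.* + (2 ^ r)) (trans fromDigits-f fromDigits-A) ⟩
    + a ℤ.* + (2 ^ r)                                         ∎
    where
      open ≡-mod-Reasoning M
      s : ℕ
      s = n ∸ r % n
      f : ℕ → ℕ
      f k = bit a (k % n)
      f-periodic : ∀ k → f (k + n) ≡ f k
      f-periodic k = cong (bit a) (ℕ.[m+n]%n≡m%n k n)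
      fromDigits-f : fromDigits n f ≡ fromDigits n A
      fromDigits-f = Σ<-cong n (λ k k<n → cong (λ t → + (bit a t * 2 ^ k)) (ℕ.m<n⇒m%n≡m k<n))

  a*G≡B+A : + (a * G r) ≡ fromDigits n B ℤ.+ fromDigits n A mod M
  a*G≡B+A = begin
    + (a * G r)                              ≡⟨ trans (ℤ.pos-* a (G r)) (cong (+ a ℤ.*_) (ℤ.pos-+ (2 ^ r) 1)) ⟩
    + a ℤ.* (+ (2 ^ r) ℤ.+ + 1)              ≡⟨ ℤ.*-distribˡ-+ (+ a) (+ (2 ^ r)) (+ 1) ⟩
    + a ℤ.* + (2 ^ r) ℤ.+ + a ℤ.* + 1        ≡⟨ cong (λ t → + a ℤ.* + (2 ^ r) ℤ.+ t) (ℤ.*-identityʳ (+ a)) ⟩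
    + a ℤ.* + (2 ^ r) ℤ.+ + a                ≈⟨ +-cong-mod (mod-sym fromDigits-B≡a*2^r) (≡⇒≡-mod (sym fromDigits-A)) ⟩
    fromDigits n B ℤ.+ fromDigits n A        ∎
    where open ≡-mod-Reasoning M

  inverse⇔B+A≡1 : IsInverseOfG n r a ⇔ fromDigits n B ℤ.+ fromDigits n A ≡ + 1 mod M
  inverse⇔B+A≡1 = mk⇔ (λ inv → mod-trans (mod-sym a*G≡B+A) (Equivalence.to aG⇔ inv))
                      (λ B+A≡1 → Equivalence.from aG⇔ (mod-trans a*G≡B+A B+A≡1))
    where aG⇔ : M ∣ a * G r ∸ 1 ⇔ + (a * G r) ≡ + 1 mod M
          aG⇔ = ∣∸1⇔≡1-mod (ℕ.*-mono-≤ 1≤a (ℕ.m≤n+m 1 (2 ^ r)))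

  A≤1 : ∀ k → k < n → A k ≤ 1
  A≤1 k _ = bit≤1 a k

  B≤1 : ∀ k → k < n → B k ≤ 1
  B≤1 k _ = bit≤1 a (shift k)

  B+A≡1-quotient-bit : (B+A≡1 : fromDigits n B ℤ.+ fromDigits n A ≡ + 1 mod M) → IsBit (_≡_mod_.quotient B+A≡1)
  B+A≡1-quotient-bit (γ , B+A≡1+γM) with fromDigits-bounded n B B≤1
  ... | b , b<2^n , B≡b = quotient-bit (ℕ.≤-trans 1≤a a≤M) (ℕ.≤-pred (subst (b <_) (2^n≡1+mersenne n) b<2^n)) 1≤a a≤M
                            (trans (sym (cong₂ ℤ._+_ B≡b fromDigits-A)) B+A≡1+γM)

  predRow : ℕ → ℕ
  predRow zero    = d ∸ 1
  predRow (suc i) = i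

  predCol : ℕ → ℕ → ℕ
  predCol zero    j = (j + e) % ℓ
  predCol (suc i) j = j

  predRow<d : ∀ {i} → i < d → predRow i < d
  predRow<d {zero}  _   = ℕ.∸-monoʳ-< {d} {1} {0} (s≤s z≤n) (>-nonZero⁻¹ d)
  predRow<d {suc i} i<d = ℕ.<-trans (ℕ.n<1+n i) i<d

  predCol<ℓ : ∀ i {j} → j < ℓ → predCol i j < ℓ
  predCol<ℓ zero    _   = ℕ.m%n<n _ ℓ
  predCol<ℓ (suc i) j<ℓ = j<ℓ

  pos-pred : ∀ i j → cyclicPred n (pos i j) ≡ pos (predRow i) (predCol i j)
  pos-pred zero    j = pos-pred-col₀ j
  pos-pred (suc i) j = pos-pred-row i j

  δ-grid : ℕ → ℕ → ℤ
  δ-grid zero    zero    = + 1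
  δ-grid zero    (suc _) = + 0
  δ-grid (suc _) _       = + 0

  pos≡0⇒origin : ∀ {i j} → i < d → j < ℓ → pos i j ≡ 0 → i ≡ 0 × j ≡ 0
  pos≡0⇒origin i<d j<ℓ pos≡0 = pos-injective i<d (>-nonZero⁻¹ d) j<ℓ (>-nonZero⁻¹ ℓ) (trans pos≡0 (sym pos-origin))

  δ₀-pos : ∀ {i j} → i < d → j < ℓ → δ₀ (pos i j) ≡ δ-grid i j
  δ₀-pos {zero}  {zero}  _   _   = cong δ₀ pos-origin
  δ₀-pos {zero}  {suc j} i<d j<ℓ = δ₀-≢0 (λ pos≡0 → case proj₂ (pos≡0⇒origin i<d j<ℓ pos≡0) of λ ())
  δ₀-pos {suc i} {j}     i<d j<ℓ = δ₀-≢0 (λ pos≡0 → case proj₁ (pos≡0⇒origin i<d j<ℓ pos≡0) of λ ())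

  GridEq : (ℕ → ℕ → ℕ) → ℕ → ℕ → Set
  GridEq c i j = + 2 ℤ.* + c i j ℤ.- + c (predRow i) (predCol i j) ℤ.+ δ-grid i j
                 ≡ + amat n r a i ((j + 1) % ℓ) ℤ.+ + amat n r a i j

  Entries01 : (ℕ → ℕ → ℕ) → Set
  Entries01 c = ∀ i j → i < d → j < ℓ → c i j ≤ 1

  CondB⇔GridEq : ∀ c → CondB n r e a c ⇔ (Entries01 c × (∀ i j → i < d → j < ℓ → GridEq c i j))
  CondB⇔GridEq c = mk⇔ to from
    where
      to : CondB n r e a c → Entries01 c × (∀ i j → i < d → j < ℓ → GridEq c i j)
      to cb = entries01 , gridEq
        where
          open CondB cb
          gridEq : ∀ i j → i < d → j < ℓ → GridEq c i j
          gridEq zero    zero    _   _   = eq00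
          gridEq zero    (suc j) _   j<ℓ = trans (ℤ.+-identityʳ _) (eq0j (suc j) (s≤s z≤n) j<ℓ)
          gridEq (suc i) j       i<d j<ℓ = trans (ℤ.+-identityʳ _) (eqij (suc i) j (s≤s z≤n) i<d j<ℓ)
      from : Entries01 c × (∀ i j → i < d → j < ℓ → GridEq c i j) → CondB n r e a c
      from (bits , gridEq) = record
        { entries01 = bits
        ; eq00 = gridEq 0 0 (>-nonZero⁻¹ d) (>-nonZero⁻¹ ℓ)
        ; eq0j = λ { (suc j) _ j<ℓ → trans (sym (ℤ.+-identityʳ _)) (gridEq 0 (suc j) (>-nonZero⁻¹ d) j<ℓ) }
        ; eqij = λ { (suc i) j _ i<d j<ℓ → trans (sym (ℤ.+-identityʳ _)) (gridEq (suc i) j i<d j<ℓ) }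
        }

  GridEq⇔CarryEq : ∀ C c → (∀ i j → i < d → j < ℓ → C (pos i j) ≡ c i j) →
                   ∀ {i j} → i < d → j < ℓ → GridEq c i j ⇔ CarryEq C (pos i j)
  GridEq⇔CarryEq C c agree {i} {j} i<d j<ℓ =
    mk⇔ (λ g → trans lhs (trans g (sym rhs))) (λ h → trans (sym lhs) (trans h rhs))
    where
      lhs : + 2 ℤ.* + C (pos i j) ℤ.- + C (cyclicPred n (pos i j)) ℤ.+ δ₀ (pos i j)
            ≡ + 2 ℤ.* + c i j ℤ.- + c (predRow i) (predCol i j) ℤ.+ δ-grid i j
      lhs = trans (cong₂ (λ x y → + 2 ℤ.* + x ℤ.- + y ℤ.+ δ₀ (pos i j))
                         (agree i j i<d j<ℓ)
                         (trans (cong C (pos-pred i j)) (agree (predRow i) (predCol i j) (predRow<d i<d) (predCol<ℓ i j<ℓ))))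
                  (cong (λ z → + 2 ℤ.* + c i j ℤ.- + c (predRow i) (predCol i j) ℤ.+ z) (δ₀-pos i<d j<ℓ))
      rhs : + B (pos i j) ℤ.+ + A (pos i j) ≡ + amat n r a i ((j + 1) % ℓ) ℤ.+ + amat n r a i j
      rhs = cong (λ k → + bit a k ℤ.+ + A (pos i j)) (sym (pos-next-col i j))

  inverse⇒condB : IsInverseOfG n r a → ∃ (CondB n r e a)
  inverse⇒condB inv = c , Equivalence.from (CondB⇔GridEq c) (bits , gridEq)
    where
      B+A≡1 : fromDigits n B ℤ.+ fromDigits n A ≡ + 1 mod M
      B+A≡1 = Equivalence.to inverse⇔B+A≡1 inv
      open _≡_mod_ B+A≡1 renaming (quotient to γ; equation to B+A≡1+γM)
      carries : ∃ λ C → (∀ k → k < n → C k ≤ 1) × (∀ k → k < n → CarryEq C k)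
      carries = sum⇒carries γ (B+A≡1-quotient-bit B+A≡1) A≤1 B≤1 B+A≡1+γM
      C : ℕ → ℕ
      C = proj₁ carries
      c : ℕ → ℕ → ℕ
      c i j = C (pos i j)
      bits : Entries01 c
      bits i j _ _ = proj₁ (proj₂ carries) (pos i j) (pos<n i j)
      gridEq : ∀ i j → i < d → j < ℓ → GridEq c i j
      gridEq i j i<d j<ℓ = Equivalence.from (GridEq⇔CarryEq C c (λ _ _ _ _ → refl) i<d j<ℓ)
                             (proj₂ (proj₂ carries) (pos i j) (pos<n i j))

  condB⇒inverse : ∀ c → CondB n r e a c → IsInverseOfG n r a
  condB⇒inverse c cb = Equivalence.from inverse⇔B+A≡1 (+ C n₀ , carries⇒sum C carryEq)
    where
      gridEq : ∀ i j → i < d → j < ℓ → GridEq c i j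
      gridEq = proj₂ (Equivalence.to (CondB⇔GridEq c) cb)
      C : ℕ → ℕ
      C k = c (row k) (col k)
      agree : ∀ i j → i < d → j < ℓ → C (pos i j) ≡ c i j
      agree i j i<d j<ℓ = cong₂ c (proj₁ (row-col-pos i<d j<ℓ)) (proj₂ (row-col-pos i<d j<ℓ))
      carryEq : ∀ k → k < n → CarryEq C k
      carryEq k k<n = subst (CarryEq C) (pos-row-col k<n)
        (Equivalence.to (GridEq⇔CarryEq C c agree (row<d k) (col<ℓ k)) (gridEq (row k) (col k) (row<d k) (col<ℓ k)))

  condB-unique : ∀ c c′ → CondB n r e a c → CondB n r e a c′ → ∀ i j → i < d → j < ℓ → c i j ≡ c′ i j
  condB-unique c c′ cb cb′ i j i<d j<ℓ =
    2x-u≡2y-v⇒x≡y (bits i j i<d j<ℓ) (bits′ i j i<d j<ℓ) (bits _ _ pi<d pj<ℓ) (bits′ _ _ pi<d pj<ℓ)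
      (∙-cancelʳ (δ-grid i j) _ _ (trans (gridEq i j i<d j<ℓ) (sym (gridEq′ i j i<d j<ℓ))))
    where
      open Σ (Equivalence.to (CondB⇔GridEq c) cb) renaming (proj₁ to bits; proj₂ to gridEq)
      open Σ (Equivalence.to (CondB⇔GridEq c′) cb′) renaming (proj₁ to bits′; proj₂ to gridEq′)
      pi<d : predRow i < d
      pi<d = predRow<d i<d
      pj<ℓ : predCol i j < ℓ
      pj<ℓ = predCol<ℓ i j<ℓ

theorem4 : (n r : ℕ) .{{_ : NonZero n}} → .{{_ : NonZero r}} →
    (e : ℕ) → 1 ≤ e → e ≤ cols n r →
    _%_ (rd n r * e) (cols n r) {{instance-cols n r}} ≡ _%_ 1 (cols n r) {{instance-cols n r}} →
    (a : ℕ) → 1 ≤ a → a ≤ 2 ^ n ∸ 2 →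
    (IsInverseOfG n r a ⇔ ∃ (λ c → CondB n r e a c))
    × (∀ c c′ → CondB n r e a c → CondB n r e a c′ →
    ∀ i j → i < dd n r → j < cols n r → c i j ≡ c′ i j)
theorem4 zero     r e _ _ _         a 1≤a a≤0 = contradiction (ℕ.≤-trans 1≤a a≤0) λ ()
-- Only e (r/d) ≡ 1 (mod n/d) is used: the bounds on e merely single out one such e.
theorem4 (suc n₀) r e _ _ e-inverse a 1≤a a≤2^n∸2 =
  mk⇔ inverse⇒condB (λ (c , cb) → condB⇒inverse c cb) , condB-unique
  where open Characterisation n₀ r e e-inverse a 1≤a a≤2^n∸2
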